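{- For every integer $t\ge2$ there is a constant $C_t>0$ such that for every even $n\ge2t$ there exists a graph $G_n$ on $n$ vertices with $\mathrm{cov}_t(G_n)/\mathrm{cov}^*_t(G_n)\ge C_t\log n$, i.e. $\mathrm{cov}_t(G_n)/\mathrm{cov}^*_t(G_n)=\Omega_t(\log n)$.
   Context: All graphs are finite and simple. A clique of $G$ is a nonempty set of pairwise adjacent vertices; $\mathcal{K}(G)$ is the set of cliques of $G$ and $\mathcal{K}_t(G)$ the set of cliques with exactly $t$ vertices. A $t$-clique cover of $G$ is $f:\mathcal{K}(G)\to\{0,1\}$ with $\sum_{K\in\mathcal{K}(G),\,T\subseteq K}f(K)\ge1$ for every $T\in\mathcal{K}_t(G)$; a fractional $t$-clique cover allows $f:\mathcal{K}(G)\to\mathbb{R}_{\ge0}$. $\mathrm{cov}_t(G)$ and $\mathrm{cov}^*_t(G)$ are the minima of $\sum_K f(K)$ over $t$-clique covers and fractional $t$-clique covers of $G$, respectively. -}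

module Defs where

open import Data.Bool using (Bool; true; false; if_then_else_)
open import Data.Nat using (ℕ; zero; suc)
open import Data.Fin using (Fin)
open import Data.Fin.Subset using (Subset; _∈_; _⊆_; ∣_∣; inside; outside)
open import Data.Fin.Subset.Properties using (_⊆?_)
open import Data.List using (List; []; _∷_; map; _++_; foldr)
open import Data.Vec using (_∷_; [])
open import Data.Rational using (ℚ; 0ℚ; 1ℚ; _+_; _≤_)
open import Data.Product using (Σ; ∃; ∃-syntax; _×_)
open import Relation.Binary.PropositionalEquality using (_≡_; _≢_)
open import Relation.Nullary using (does)

record Graph (n : ℕ) : Set where
  field
    adj    : Fin n → Fin n → Bool
    sym    : ∀ x y → adj x y ≡ adj y x
    irrefl : ∀ x → adj x x ≡ false
open Graph public

IsClique : ∀ {n} → Graph n → Subset n → Set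
IsClique G K =
  (∃[ x ] x ∈ K) × (∀ x y → x ∈ K → y ∈ K → x ≢ y → adj G x y ≡ true)

IsTClique : ∀ {n} → Graph n → ℕ → Subset n → Set
IsTClique G t T = IsClique G T × ∣ T ∣ ≡ t

allSubsets : ∀ n → List (Subset n)
allSubsets zero = [] ∷ []
allSubsets (suc n) = map (outside ∷_) (allSubsets n) ++ map (inside ∷_) (allSubsets n)

Σℚ : ∀ {n} → (Subset n → ℚ) → ℚ
Σℚ {n} f = foldr (λ K acc → f K + acc) 0ℚ (allSubsets n)

Σℕ : ∀ {n} → (Subset n → ℕ) → ℕ
Σℕ {n} f = foldr (λ K acc → f K Data.Nat.+ acc) 0 (allSubsets n)

Σℚ⊇ : ∀ {n} → Subset n → (Subset n → ℚ) → ℚ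
Σℚ⊇ T f = Σℚ (λ K → if does (T ⊆? K) then f K else 0ℚ)

Σℕ⊇ : ∀ {n} → Subset n → (Subset n → ℕ) → ℕ
Σℕ⊇ T f = Σℕ (λ K → if does (T ⊆? K) then f K else 0)

𝟙 : Bool → ℕ
𝟙 true = 1
𝟙 false = 0

-- A t-clique cover: f : K(G) → {0,1}, represented as a function on all subsets
-- that is 0 (false) outside K(G); every t-clique T has Σ_{K ⊇ T} f(K) ≥ 1.
IsTCliqueCover : ∀ {n} → Graph n → ℕ → (Subset n → Bool) → Set
IsTCliqueCover G t f =
  (∀ K → f K ≡ true → IsClique G K) ×
  (∀ T → IsTClique G t T → 1 Data.Nat.≤ Σℕ⊇ T (λ K → 𝟙 (f K)))

coverSize : ∀ {n} → (Subset n → Bool) → ℕ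
coverSize f = Σℕ (λ K → 𝟙 (f K))

-- A fractional t-clique cover: f : K(G) → ℚ≥0, represented as a function on
-- all subsets vanishing outside K(G); every t-clique T has Σ_{K ⊇ T} f(K) ≥ 1.
IsFracTCliqueCover : ∀ {n} → Graph n → ℕ → (Subset n → ℚ) → Set
IsFracTCliqueCover G t f =
  (∀ K → 0ℚ ≤ f K) ×
  (∀ K → f K ≢ 0ℚ → IsClique G K) ×
  (∀ T → IsTClique G t T → 1ℚ ≤ Σℚ⊇ T f)

fracWeight : ∀ {n} → (Subset n → ℚ) → ℚ
fracWeight = Σℚ

-- The graph is the cocktail party graph on n = 2k vertices: k disjoint non-edges ("couples"), all
-- other pairs adjacent. Its cliques are the nonempty sets meeting every couple at most once, and
-- its maximal cliques are the 2^k transversals of the couples. Giving each transversal weight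
-- 2^t / 2^k is a fractional t-clique cover of weight 2^t, because a t-clique lies in exactly a
-- 2^-t fraction of the transversals. For integral covers, fix s = t - 2 couples and, for distinct
-- i and j among the other p = k - s couples, the t-clique made of the left vertices of the fixed
-- couples, the left vertex of couple i and the right vertex of couple j. A cover clique containing
-- it contains the left vertex of i but not that of j, so the sets of cover cliques containing the
-- left vertices of these p couples are pairwise distinct and p ≤ 2^cov_t. Since p ≥ 2 and
-- n ≤ 2^t p, this gives log₂ n ≤ 2^t cov_t, i.e. C_t = 4^-t.

module Submission where

open import Defs
open import Data.Nat using (ℕ; _*_)
open import Data.Nat.Logarithm using (⌊log₂_⌋)
open import Data.Rational using (ℚ; 0ℚ; _<_; _≤_; _/_)
open import Data.Integer using (+_)
open import Data.Product using (∃-syntax; _×_; _,_)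

open import Data.Bool using (Bool; true; false; not; _∧_; if_then_else_)
open import Data.Nat as ℕ using (zero; suc; _^_; z≤n; s≤s)
import Data.Nat.Properties as ℕₚ
import Data.Nat.Coprimality as Coprimality
open import Data.Nat.Logarithm using (⌊log₂⌋-mono-≤; ⌊log₂[2^n]⌋≡n)
import Data.Integer as ℤ
import Data.Integer.Properties as ℤₚ
open import Data.Rational as ℚ using (1ℚ; ½; NonNegative; Positive)
import Data.Rational.Properties as ℚₚ
open import Data.Rational.Solver using (module +-*-Solver)
open import Data.Fin as Fin using (Fin; zero; suc; combine; _↑ʳ_)
open import Data.Fin.Properties using (_≟_; suc-injective; combine-injective; injective⇒≤)
open import Data.Fin.Subset
  using (Subset; inside; outside; _∈_; _∉_; _⊆_; ∣_∣; ⁅_⁆; Nonempty) renaming (⊥ to ∅)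
open import Data.Fin.Subset.Properties
  using (_⊆?_; ⊆-min; ∉⊥; ∣⊥∣≡0; x∈⁅x⁆; x∈⁅y⁆⇒x≡y; ∣⁅x⁆∣≡1)
open import Data.List as List using (List; foldr; map; filterᵇ; length)
import Data.List.Properties as Listₚ
open import Data.List.Relation.Unary.Any as Any using (Any; here; there)
open import Data.List.Relation.Unary.Any.Properties using (lookup-index)
open import Data.Vec as Vec using ([]; _∷_; _++_; here; there)
open import Data.Vec.Properties using ([]=⇒lookup; lookup⇒[]=)
open import Data.Sum using (_⊎_; inj₁; inj₂)
open import Function using (_∘_)
open import Function.Bundles using (mk⇔)
open import Relation.Nullary using (does; yes; no; ¬_; contradiction)
open import Relation.Nullary.Decidable using (dec-true; dec-false; does-⇔)
open import Relation.Binary.PropositionalEquality as ≡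
  using (_≡_; _≢_; refl; cong; cong₂; trans; subst; module ≡-Reasoning)

toℚ : ℕ → ℚ
toℚ n = + n / 1

-- + n / 1 normalises to mkℚ (+ n) 0 _, on which _+_ computes.
toℚ-suc : ∀ n → toℚ (suc n) ≡ 1ℚ ℚ.+ toℚ n
toℚ-suc n rewrite ℚₚ.normalize-coprime (Coprimality.sym (Coprimality.1-coprimeTo n)) =
  cong (λ z → (+ 1 ℤ.+ z) / 1) (≡.sym (ℤₚ.*-identityʳ (+ n)))

toℚ-+ : ∀ m n → toℚ (m ℕ.+ n) ≡ toℚ m ℚ.+ toℚ n
toℚ-+ zero n = ≡.sym (ℚₚ.+-identityˡ (toℚ n))
toℚ-+ (suc m) n = begin
  toℚ (suc m ℕ.+ n)            ≡⟨ toℚ-suc (m ℕ.+ n) ⟩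
  1ℚ ℚ.+ toℚ (m ℕ.+ n)         ≡⟨ cong (1ℚ ℚ.+_) (toℚ-+ m n) ⟩
  1ℚ ℚ.+ (toℚ m ℚ.+ toℚ n)     ≡⟨ ≡.sym (ℚₚ.+-assoc 1ℚ (toℚ m) (toℚ n)) ⟩
  (1ℚ ℚ.+ toℚ m) ℚ.+ toℚ n     ≡⟨ cong (ℚ._+ toℚ n) (≡.sym (toℚ-suc m)) ⟩
  toℚ (suc m) ℚ.+ toℚ n        ∎
  where open ≡-Reasoning

toℚ-* : ∀ m n → toℚ (m ℕ.* n) ≡ toℚ m ℚ.* toℚ n
toℚ-* zero n = ≡.sym (ℚₚ.*-zeroˡ (toℚ n))
toℚ-* (suc m) n = begin
  toℚ (n ℕ.+ m ℕ.* n)                ≡⟨ toℚ-+ n (m ℕ.* n) ⟩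
  toℚ n ℚ.+ toℚ (m ℕ.* n)            ≡⟨ cong₂ ℚ._+_ (≡.sym (ℚₚ.*-identityˡ (toℚ n))) (toℚ-* m n) ⟩
  1ℚ ℚ.* toℚ n ℚ.+ toℚ m ℚ.* toℚ n  ≡⟨ ≡.sym (ℚₚ.*-distribʳ-+ (toℚ n) 1ℚ (toℚ m)) ⟩
  (1ℚ ℚ.+ toℚ m) ℚ.* toℚ n          ≡⟨ cong (ℚ._* toℚ n) (≡.sym (toℚ-suc m)) ⟩
  toℚ (suc m) ℚ.* toℚ n              ∎
  where open ≡-Reasoning

toℚ-nonNeg : ∀ n → NonNegative (toℚ n)
toℚ-nonNeg n = ℚₚ.normalize-nonNeg n 1

toℚ-mono-≤ : ∀ {m n} → m ℕ.≤ n → toℚ m ≤ toℚ n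
toℚ-mono-≤ {m} {n} m≤n = begin
  toℚ m                      ≡⟨ ≡.sym (ℚₚ.+-identityʳ (toℚ m)) ⟩
  toℚ m ℚ.+ 0ℚ               ≤⟨ ℚₚ.+-monoʳ-≤ (toℚ m) (ℚₚ.nonNegative⁻¹ _ {{toℚ-nonNeg (n ℕ.∸ m)}}) ⟩
  toℚ m ℚ.+ toℚ (n ℕ.∸ m)    ≡⟨ ≡.sym (toℚ-+ m (n ℕ.∸ m)) ⟩
  toℚ (m ℕ.+ (n ℕ.∸ m))      ≡⟨ cong toℚ (ℕₚ.m+[n∸m]≡n m≤n) ⟩
  toℚ n                      ∎
  where open ℚₚ.≤-Reasoning

½^_ : ℕ → ℚ
½^ zero = 1ℚ
½^ suc e = ½ ℚ.* ½^ e

½^-pos : ∀ e → Positive (½^ e)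
½^-pos zero = _
½^-pos (suc e) = ℚₚ.pos*pos⇒pos ½ (½^ e) {{½^-pos e}}

toℚ[2^e]*½^e≡1 : ∀ e → toℚ (2 ^ e) ℚ.* ½^ e ≡ 1ℚ
toℚ[2^e]*½^e≡1 zero = refl
toℚ[2^e]*½^e≡1 (suc e) = begin
  toℚ (2 ℕ.* 2 ^ e) ℚ.* (½ ℚ.* ½^ e)
    ≡⟨ cong (ℚ._* (½ ℚ.* ½^ e)) (toℚ-* 2 (2 ^ e)) ⟩
  (toℚ 2 ℚ.* toℚ (2 ^ e)) ℚ.* (½ ℚ.* ½^ e)
    ≡⟨ solve 4 (λ a b c d → (a :* b) :* (c :* d) := (a :* c) :* (b :* d)) refl (toℚ 2) (toℚ (2 ^ e)) ½ (½^ e) ⟩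
  (toℚ 2 ℚ.* ½) ℚ.* (toℚ (2 ^ e) ℚ.* ½^ e)
    ≡⟨⟩
  1ℚ ℚ.* (toℚ (2 ^ e) ℚ.* ½^ e)
    ≡⟨ cong (1ℚ ℚ.*_) (toℚ[2^e]*½^e≡1 e) ⟩
  1ℚ ℚ.* 1ℚ
    ≡⟨⟩
  1ℚ ∎
  where
  open ≡-Reasoning
  open +-*-Solver

*≢0ˡ : ∀ {p q} → p ℚ.* q ≢ 0ℚ → p ≢ 0ℚ
*≢0ˡ {q = q} pq≢0 p≡0 = pq≢0 (trans (cong (ℚ._* q) p≡0) (ℚₚ.*-zeroˡ q))

*≢0ʳ : ∀ {p q} → p ℚ.* q ≢ 0ℚ → q ≢ 0ℚ
*≢0ʳ {p} pq≢0 q≡0 = pq≢0 (trans (cong (p ℚ.*_) q≡0) (ℚₚ.*-zeroʳ p))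

sumℚ : {A : Set} → (A → ℚ) → List A → ℚ
sumℚ h = foldr (λ x acc → h x ℚ.+ acc) 0ℚ

module _ {A : Set} where

  sumℚ-++ : ∀ (h : A → ℚ) xs ys → sumℚ h (xs List.++ ys) ≡ sumℚ h xs ℚ.+ sumℚ h ys
  sumℚ-++ h List.[] ys = ≡.sym (ℚₚ.+-identityˡ _)
  sumℚ-++ h (x List.∷ xs) ys =
    trans (cong (h x ℚ.+_) (sumℚ-++ h xs ys)) (≡.sym (ℚₚ.+-assoc (h x) _ _))

  sumℚ-cong : ∀ {h h′ : A → ℚ} xs → (∀ x → h x ≡ h′ x) → sumℚ h xs ≡ sumℚ h′ xs
  sumℚ-cong List.[] eq = refl
  sumℚ-cong (x List.∷ xs) eq = cong₂ ℚ._+_ (eq x) (sumℚ-cong xs eq)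

  sumℚ-*ˡ : ∀ c (h : A → ℚ) xs → sumℚ (λ x → c ℚ.* h x) xs ≡ c ℚ.* sumℚ h xs
  sumℚ-*ˡ c h List.[] = ≡.sym (ℚₚ.*-zeroʳ c)
  sumℚ-*ˡ c h (x List.∷ xs) =
    trans (cong (c ℚ.* h x ℚ.+_) (sumℚ-*ˡ c h xs)) (≡.sym (ℚₚ.*-distribˡ-+ c (h x) _))

  sumℚ-*ʳ : ∀ c (h : A → ℚ) xs → sumℚ (λ x → h x ℚ.* c) xs ≡ sumℚ h xs ℚ.* c
  sumℚ-*ʳ c h List.[] = ≡.sym (ℚₚ.*-zeroˡ c)
  sumℚ-*ʳ c h (x List.∷ xs) =
    trans (cong (h x ℚ.* c ℚ.+_) (sumℚ-*ʳ c h xs)) (≡.sym (ℚₚ.*-distribʳ-+ c (h x) _))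

Σℚ-∷ : ∀ {n} (h : Subset (suc n) → ℚ) →
       Σℚ h ≡ Σℚ (λ K → h (outside ∷ K)) ℚ.+ Σℚ (λ K → h (inside ∷ K))
Σℚ-∷ {n} h = trans (sumℚ-++ h (map (outside ∷_) (allSubsets n)) (map (inside ∷_) (allSubsets n)))
  (cong₂ ℚ._+_ (Listₚ.foldr-map _ (outside ∷_) 0ℚ (allSubsets n))
               (Listₚ.foldr-map _ (inside ∷_) 0ℚ (allSubsets n)))

Σℚ-++ : ∀ m {n} (h : Subset (m ℕ.+ n) → ℚ) →
        Σℚ h ≡ Σℚ {m} (λ u → Σℚ {n} (λ v → h (u ++ v)))
Σℚ-++ zero h = ≡.sym (ℚₚ.+-identityʳ _)
Σℚ-++ (suc m) h = trans (Σℚ-∷ h)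
  (trans (cong₂ ℚ._+_ (Σℚ-++ m (λ K → h (outside ∷ K))) (Σℚ-++ m (λ K → h (inside ∷ K))))
    (≡.sym (Σℚ-∷ {m} (λ u → Σℚ (λ v → h (u ++ v))))))

if-*ˡ : ∀ c b x → (if b then c ℚ.* x else 0ℚ) ≡ c ℚ.* (if b then x else 0ℚ)
if-*ˡ c true x = refl
if-*ˡ c false x = ≡.sym (ℚₚ.*-zeroʳ c)

if-∧-* : ∀ b b′ x y →
         (if b ∧ b′ then x ℚ.* y else 0ℚ) ≡ (if b then x else 0ℚ) ℚ.* (if b′ then y else 0ℚ)
if-∧-* true true x y = refl
if-∧-* true false x y = ≡.sym (ℚₚ.*-zeroʳ x)
if-∧-* false b′ x y = ≡.sym (ℚₚ.*-zeroˡ (if b′ then y else 0ℚ))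

Σℚ⊇-*ˡ : ∀ {n} (T : Subset n) c h → Σℚ⊇ T (λ K → c ℚ.* h K) ≡ c ℚ.* Σℚ⊇ T h
Σℚ⊇-*ˡ {n} T c h = trans (sumℚ-cong (allSubsets n) (λ K → if-*ˡ c (does (T ⊆? K)) (h K)))
                          (sumℚ-*ˡ c (λ K → if does (T ⊆? K) then h K else 0ℚ) (allSubsets n))

Σℚ⊇-∅ : ∀ {n} (h : Subset n → ℚ) → Σℚ⊇ ∅ h ≡ Σℚ h
Σℚ⊇-∅ {n} h =
  sumℚ-cong (allSubsets n) (λ K → cong (λ b → if b then h K else 0ℚ) (dec-true (∅ ⊆? K) (⊆-min K)))

⊆?-++ : ∀ {m n} (S U : Subset m) {T V : Subset n} →
        does ((S ++ T) ⊆? (U ++ V)) ≡ does (S ⊆? U) ∧ does (T ⊆? V)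
⊆?-++ [] [] = refl
⊆?-++ (outside ∷ S) (_ ∷ U) = ⊆?-++ S U
⊆?-++ (inside ∷ S) (outside ∷ U) = refl
⊆?-++ (inside ∷ S) (inside ∷ U) = ⊆?-++ S U

-- The cocktail party graph

double : ℕ → ℕ
double zero = zero
double (suc k) = suc (suc (double k))

-- Vertices 2l and 2l+1, that is left l and right l, form the l-th couple.
couple : ∀ {k} → Fin (double k) → Fin k
couple {suc k} zero = zero
couple {suc k} (suc zero) = zero
couple {suc k} (suc (suc x)) = suc (couple x)

left right : ∀ {k} → Fin k → Fin (double k)
left zero = zero
left (suc l) = suc (suc (left l))
right zero = suc zero
right (suc l) = suc (suc (right l))

couple-left : ∀ {k} (l : Fin k) → couple (left l) ≡ l
couple-left zero = refl
couple-left (suc l) = cong suc (couple-left l)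

couple-right : ∀ {k} (l : Fin k) → couple (right l) ≡ l
couple-right zero = refl
couple-right (suc l) = cong suc (couple-right l)

left≢right : ∀ {k} (l : Fin k) → left l ≢ right l
left≢right (suc l) eq = left≢right l (suc-injective (suc-injective eq))

∏couples : (Bool → Bool → ℚ) → ∀ {k} → Subset (double k) → ℚ
∏couples w {zero} [] = 1ℚ
∏couples w {suc k} (x ∷ y ∷ K) = w x y ℚ.* ∏couples w K

onCouple : (Bool → Bool → ℚ) → Subset 2 → ℚ
onCouple w (x ∷ y ∷ []) = w x y

coupleMass : (Bool → Bool → ℚ) → Bool → Bool → ℚ
coupleMass w a b = Σℚ⊇ (a ∷ b ∷ []) (onCouple w)

Σℚ⊇-∏couples : ∀ w {k} (T : Subset (double k)) →
               Σℚ⊇ T (∏couples w) ≡ ∏couples (coupleMass w) T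
Σℚ⊇-∏couples w {zero} [] = refl
Σℚ⊇-∏couples w {suc k} (a ∷ b ∷ T) = begin
  Σℚ⊇ (a ∷ b ∷ T) (∏couples w)
    ≡⟨ Σℚ-++ 2 (λ K → if does ((a ∷ b ∷ T) ⊆? K) then ∏couples w K else 0ℚ) ⟩
  Σℚ {2} (λ u → Σℚ (λ v → if does ((a ∷ b ∷ T) ⊆? (u ++ v)) then ∏couples w (u ++ v) else 0ℚ))
    ≡⟨ sumℚ-cong (allSubsets 2) factor ⟩
  Σℚ {2} (λ u → (if does ((a ∷ b ∷ []) ⊆? u) then onCouple w u else 0ℚ) ℚ.* Σℚ⊇ T (∏couples w))
    ≡⟨ sumℚ-*ʳ _ (λ u → if does ((a ∷ b ∷ []) ⊆? u) then onCouple w u else 0ℚ) (allSubsets 2) ⟩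
  coupleMass w a b ℚ.* Σℚ⊇ T (∏couples w)
    ≡⟨ cong (coupleMass w a b ℚ.*_) (Σℚ⊇-∏couples w T) ⟩
  ∏couples (coupleMass w) (a ∷ b ∷ T) ∎
  where
  open ≡-Reasoning
  factor : ∀ u → Σℚ (λ v → if does ((a ∷ b ∷ T) ⊆? (u ++ v)) then ∏couples w (u ++ v) else 0ℚ)
               ≡ (if does ((a ∷ b ∷ []) ⊆? u) then onCouple w u else 0ℚ) ℚ.* Σℚ⊇ T (∏couples w)
  factor u@(x ∷ y ∷ []) = trans
    (sumℚ-cong (allSubsets _) λ v →
      trans (cong (λ β → if β then w x y ℚ.* ∏couples w v else 0ℚ) (⊆?-++ (a ∷ b ∷ []) u))
            (if-∧-* (does ((a ∷ b ∷ []) ⊆? u)) (does (T ⊆? v)) (w x y) (∏couples w v)))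
    (sumℚ-*ˡ (if does ((a ∷ b ∷ []) ⊆? u) then w x y else 0ℚ)
             (λ v → if does (T ⊆? v) then ∏couples w v else 0ℚ) (allSubsets _))

cocktailParty : ∀ k → Graph (double k)
cocktailParty k = record
  { adj = λ x y → not (does (couple x ≟ couple y))
  ; sym = λ x y → cong not (does-⇔ (mk⇔ ≡.sym ≡.sym) (couple x ≟ couple y) (couple y ≟ couple x))
  ; irrefl = λ x → cong not (dec-true (couple x ≟ couple x) refl)
  }

module _ {k : ℕ} where

  adj⇒differentCouples : ∀ {x y} → adj (cocktailParty k) x y ≡ true → couple x ≢ couple y
  adj⇒differentCouples {x} {y} xy same
    with () ← trans (≡.sym xy) (cong not (dec-true (couple x ≟ couple y) same))

  differentCouples⇒adj : ∀ {x y} → couple x ≢ couple y → adj (cocktailParty k) x y ≡ true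
  differentCouples⇒adj {x} {y} ne = cong not (dec-false (couple x ≟ couple y) ne)

IsPartialTransversal : ∀ {k} → Subset (double k) → Set
IsPartialTransversal K = ∀ {x y} → x ∈ K → y ∈ K → x ≢ y → couple x ≢ couple y

module _ {k : ℕ} {K : Subset (double k)} where

  clique⇒partialTransversal : IsClique (cocktailParty k) K → IsPartialTransversal K
  clique⇒partialTransversal (_ , adjacent) x∈K y∈K x≢y =
    adj⇒differentCouples (adjacent _ _ x∈K y∈K x≢y)

  partialTransversal⇒clique : Nonempty K → IsPartialTransversal K → IsClique (cocktailParty k) K
  partialTransversal⇒clique nonempty pt =
    nonempty , λ _ _ x∈K y∈K x≢y → differentCouples⇒adj (pt x∈K y∈K x≢y)

  partialTransversal-omits : IsPartialTransversal K → ∀ {l} → right l ∈ K → left l ∉ K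
  partialTransversal-omits pt {l} r∈K l∈K =
    pt l∈K r∈K (left≢right l) (trans (couple-left l) (≡.sym (couple-right l)))

module _ {k : ℕ} {a b : Bool} {K : Subset (double k)} where

  partialTransversal-∷⁻ : IsPartialTransversal (a ∷ b ∷ K) →
                          ¬ (a ≡ inside × b ≡ inside) × IsPartialTransversal K
  partialTransversal-∷⁻ pt =
    (λ { (refl , refl) → pt here (there here) (λ ()) refl }) ,
    λ x∈K y∈K x≢y same →
      pt (there (there x∈K)) (there (there y∈K)) (x≢y ∘ suc-injective ∘ suc-injective) (cong suc same)

  partialTransversal-∷⁺ : ¬ (a ≡ inside × b ≡ inside) → IsPartialTransversal K →
                          IsPartialTransversal (a ∷ b ∷ K)
  partialTransversal-∷⁺ notBoth pt here here x≢y = contradiction refl x≢y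
  partialTransversal-∷⁺ notBoth pt here (there here) _ = contradiction (refl , refl) notBoth
  partialTransversal-∷⁺ notBoth pt here (there (there _)) _ = λ ()
  partialTransversal-∷⁺ notBoth pt (there here) here _ = contradiction (refl , refl) notBoth
  partialTransversal-∷⁺ notBoth pt (there here) (there here) x≢y = contradiction refl x≢y
  partialTransversal-∷⁺ notBoth pt (there here) (there (there _)) _ = λ ()
  partialTransversal-∷⁺ notBoth pt (there (there _)) here _ = λ ()
  partialTransversal-∷⁺ notBoth pt (there (there _)) (there here) _ = λ ()
  partialTransversal-∷⁺ notBoth pt (there (there x∈K)) (there (there y∈K)) x≢y =
    λ same → pt x∈K y∈K (λ x≡y → x≢y (cong (λ z → suc (suc z)) x≡y)) (suc-injective same)

-- A fractional cover of weight 2^t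

oneOfTwo : Bool → Bool → ℚ
oneOfTwo false false = 0ℚ
oneOfTwo false true = ½
oneOfTwo true false = ½
oneOfTwo true true = 0ℚ

-- The uniform probability measure on the 2^k transversals, i.e. on the maximal cliques.
uniformTransversal : ∀ {k} → Subset (double k) → ℚ
uniformTransversal = ∏couples oneOfTwo

-- coupleMass oneOfTwo a b computes to 1, ½, ½ and 0 on (outside, outside), (outside, inside),
-- (inside, outside) and (inside, inside).
∏couplesMass-partialTransversal : ∀ {k} {T : Subset (double k)} → IsPartialTransversal T →
                                  ∏couples (coupleMass oneOfTwo) T ≡ ½^ ∣ T ∣
∏couplesMass-partialTransversal {zero} {[]} _ = refl
∏couplesMass-partialTransversal {suc k} {a ∷ b ∷ T} pt with partialTransversal-∷⁻ pt
... | notBoth , ptT with a | b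
...   | false | false = trans (ℚₚ.*-identityˡ _) (∏couplesMass-partialTransversal ptT)
...   | false | true  = cong (½ ℚ.*_) (∏couplesMass-partialTransversal ptT)
...   | true  | false = cong (½ ℚ.*_) (∏couplesMass-partialTransversal ptT)
...   | true  | true  = contradiction (refl , refl) notBoth

Σℚ⊇-uniformTransversal : ∀ {k} {T : Subset (double k)} → IsPartialTransversal T →
                         Σℚ⊇ T uniformTransversal ≡ ½^ ∣ T ∣
Σℚ⊇-uniformTransversal {T = T} pt =
  trans (Σℚ⊇-∏couples oneOfTwo T) (∏couplesMass-partialTransversal pt)

Σℚ-uniformTransversal : ∀ k → Σℚ (uniformTransversal {k}) ≡ 1ℚ
Σℚ-uniformTransversal k = begin
  Σℚ (uniformTransversal {k})     ≡⟨ ≡.sym (Σℚ⊇-∅ (uniformTransversal {k})) ⟩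
  Σℚ⊇ ∅ (uniformTransversal {k})  ≡⟨ Σℚ⊇-uniformTransversal {k} {∅} (λ x∈∅ → contradiction x∈∅ ∉⊥) ⟩
  ½^ ∣ ∅ {double k} ∣             ≡⟨ cong ½^_ (∣⊥∣≡0 (double k)) ⟩
  1ℚ                              ∎
  where open ≡-Reasoning

uniformTransversal-nonNeg : ∀ {k} (K : Subset (double k)) → NonNegative (uniformTransversal K)
uniformTransversal-nonNeg {zero} [] = _
uniformTransversal-nonNeg {suc k} (x ∷ y ∷ K) =
  ℚₚ.nonNeg*nonNeg⇒nonNeg (oneOfTwo x y) {{factor x y}}
                          (uniformTransversal K) {{uniformTransversal-nonNeg K}}
  where
  factor : ∀ x y → NonNegative (oneOfTwo x y)
  factor false false = _
  factor false true = _
  factor true false = _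
  factor true true = _

uniformTransversal≢0⇒partialTransversal : ∀ {k} {K : Subset (double k)} →
  uniformTransversal K ≢ 0ℚ → IsPartialTransversal K
uniformTransversal≢0⇒partialTransversal {zero} {[]} _ ()
uniformTransversal≢0⇒partialTransversal {suc k} {x ∷ y ∷ K} ≢0 =
  partialTransversal-∷⁺ (λ { (refl , refl) → *≢0ˡ {oneOfTwo true true} {uniformTransversal K} ≢0 refl })
    (uniformTransversal≢0⇒partialTransversal (*≢0ʳ {oneOfTwo x y} ≢0))

uniformTransversal≢0⇒meets : ∀ {k} {K : Subset (double k)} →
  uniformTransversal K ≢ 0ℚ → ∀ l → left l ∈ K ⊎ right l ∈ K
uniformTransversal≢0⇒meets {K = true ∷ y ∷ K} ≢0 zero = inj₁ here
uniformTransversal≢0⇒meets {K = false ∷ true ∷ K} ≢0 zero = inj₂ (there here)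
uniformTransversal≢0⇒meets {K = false ∷ false ∷ K} ≢0 zero =
  contradiction refl (*≢0ˡ {oneOfTwo false false} {uniformTransversal K} ≢0)
uniformTransversal≢0⇒meets {K = x ∷ y ∷ K} ≢0 (suc l)
  with uniformTransversal≢0⇒meets (*≢0ʳ {oneOfTwo x y} ≢0) l
... | inj₁ l∈K = inj₁ (there (there l∈K))
... | inj₂ r∈K = inj₂ (there (there r∈K))

transversalCover : ℕ → ∀ {k} → Subset (double k) → ℚ
transversalCover t K = toℚ (2 ^ t) ℚ.* uniformTransversal K

fracWeight-transversalCover : ∀ t k → fracWeight (transversalCover t {k}) ≡ toℚ (2 ^ t)
fracWeight-transversalCover t k = begin
  Σℚ (transversalCover t {k})                  ≡⟨ sumℚ-*ˡ (toℚ (2 ^ t)) uniformTransversal (allSubsets (double k)) ⟩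
  toℚ (2 ^ t) ℚ.* Σℚ (uniformTransversal {k})  ≡⟨ cong (toℚ (2 ^ t) ℚ.*_) (Σℚ-uniformTransversal k) ⟩
  toℚ (2 ^ t) ℚ.* 1ℚ                           ≡⟨ ℚₚ.*-identityʳ (toℚ (2 ^ t)) ⟩
  toℚ (2 ^ t)                                  ∎
  where open ≡-Reasoning

transversalCover-isFracTCliqueCover : ∀ t {k} → 0 ℕ.< k →
                                      IsFracTCliqueCover (cocktailParty k) t (transversalCover t)
transversalCover-isFracTCliqueCover t {k} 0<k = nonNeg , support , covers
  where
  c = toℚ (2 ^ t)
  nonNeg : ∀ K → 0ℚ ≤ transversalCover t K
  nonNeg K = ℚₚ.nonNegative⁻¹ _
    {{ℚₚ.nonNeg*nonNeg⇒nonNeg c {{toℚ-nonNeg (2 ^ t)}}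
                              (uniformTransversal K) {{uniformTransversal-nonNeg K}}}}
  support : ∀ K → transversalCover t K ≢ 0ℚ → IsClique (cocktailParty k) K
  support K ≢0 = partialTransversal⇒clique nonempty (uniformTransversal≢0⇒partialTransversal ≢0′)
    where
    ≢0′ = *≢0ʳ {c} ≢0
    nonempty : Nonempty K
    nonempty with uniformTransversal≢0⇒meets ≢0′ (Fin.fromℕ< 0<k)
    ... | inj₁ l∈K = _ , l∈K
    ... | inj₂ r∈K = _ , r∈K
  covers : ∀ T → IsTClique (cocktailParty k) t T → 1ℚ ≤ Σℚ⊇ T (transversalCover t)
  covers T (clique , ∣T∣≡t) = ℚₚ.≤-reflexive (≡.sym (begin
    Σℚ⊇ T (transversalCover t)
      ≡⟨ Σℚ⊇-*ˡ T c uniformTransversal ⟩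
    c ℚ.* Σℚ⊇ T uniformTransversal
      ≡⟨ cong (c ℚ.*_) (Σℚ⊇-uniformTransversal (clique⇒partialTransversal clique)) ⟩
    c ℚ.* ½^ ∣ T ∣
      ≡⟨ cong (λ e → c ℚ.* ½^ e) ∣T∣≡t ⟩
    c ℚ.* ½^ t
      ≡⟨ toℚ[2^e]*½^e≡1 t ⟩
    1ℚ ∎))
    where open ≡-Reasoning

-- Lower bound for integral covers

bit : Bool → Fin 2
bit false = zero
bit true = suc zero

bit-injective : ∀ {x y} → bit x ≡ bit y → x ≡ y
bit-injective {false} {false} _ = refl
bit-injective {true} {true} _ = refl

encode : ∀ {m} → (Fin m → Bool) → Fin (2 ^ m)
encode {zero} _ = zero
encode {suc m} h = combine (bit (h zero)) (encode (h ∘ suc))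

encode-injective : ∀ {m} {h h′ : Fin m → Bool} → encode h ≡ encode h′ → ∀ ι → h ι ≡ h′ ι
encode-injective {suc m} {h} {h′} eq ι
  with combine-injective (bit (h zero)) (encode (h ∘ suc)) (bit (h′ zero)) (encode (h′ ∘ suc)) eq
encode-injective {suc m} eq zero    | head≡ , _ = bit-injective head≡
encode-injective {suc m} eq (suc ι) | _ , tail≡ = encode-injective tail≡ ι

separating⇒≤2^ : ∀ {m p} (test : Fin m → Fin p → Bool) →
                 (∀ {i j} → i ≢ j → ∃[ ι ] test ι i ≢ test ι j) → p ℕ.≤ 2 ^ m
separating⇒≤2^ test separates = injective⇒≤ {f = λ i → encode (λ ι → test ι i)} signature-injective
  where
  signature-injective : ∀ {i j} → encode (λ ι → test ι i) ≡ encode (λ ι → test ι j) → i ≡ j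
  signature-injective {i} {j} eq with i ≟ j
  ... | yes i≡j = i≡j
  ... | no i≢j = let ι , differ = separates i≢j in contradiction (encode-injective eq ι) differ

module _ {n : ℕ} (g : Subset n → Bool) where

  count≡length-filterᵇ : ∀ xs → foldr (λ K acc → 𝟙 (g K) ℕ.+ acc) 0 xs ≡ length (filterᵇ g xs)
  count≡length-filterᵇ List.[] = refl
  count≡length-filterᵇ (x List.∷ xs) with g x
  ... | true = cong suc (count≡length-filterᵇ xs)
  ... | false = count≡length-filterᵇ xs

  covered⇒any-filterᵇ : ∀ (T : Subset n) xs →
    1 ℕ.≤ foldr (λ K acc → (if does (T ⊆? K) then 𝟙 (g K) else 0) ℕ.+ acc) 0 xs →
    Any (λ K → T ⊆ K × g K ≡ true) (filterᵇ g xs)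
  covered⇒any-filterᵇ T (x List.∷ xs) covered with g x in gx | T ⊆? x
  ... | true  | yes T⊆x = here (T⊆x , gx)
  ... | true  | no _    = there (covered⇒any-filterᵇ T xs covered)
  ... | false | yes _   = covered⇒any-filterᵇ T xs covered
  ... | false | no _    = covered⇒any-filterᵇ T xs covered

≤2^coverSize : ∀ {n t p} (G : Graph n) {g : Subset n → Bool} → IsTCliqueCover G t g →
  (u : Fin p → Fin n) →
  (∀ {i j} → i ≢ j →
    ∃[ T ] IsTClique G t T × u i ∈ T × (∀ K → IsClique G K → T ⊆ K → u j ∉ K)) →
  p ℕ.≤ 2 ^ coverSize g
≤2^coverSize {n} {p = p} G {g} (cliques , covers) u separated =
  subst (λ m → p ℕ.≤ 2 ^ m) (≡.sym (count≡length-filterᵇ g (allSubsets n)))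
    (separating⇒≤2^ test separates)
  where
  chosen = filterᵇ g (allSubsets n)
  test : Fin (length chosen) → Fin p → Bool
  test ι i = Vec.lookup (List.lookup chosen ι) (u i)
  separates : ∀ {i j} → i ≢ j → ∃[ ι ] test ι i ≢ test ι j
  separates {i} {j} i≢j =
    let T , isT , uᵢ∈T , omits = separated i≢j
        covering = covered⇒any-filterᵇ g T (allSubsets n) (covers T isT)
        K = List.lookup chosen (Any.index covering)
        T⊆K , gK = lookup-index covering
    in Any.index covering , λ same →
         omits K (cliques K gK) T⊆K (lookup⇒[]= (u j) K (trans (≡.sym same) ([]=⇒lookup (T⊆K uᵢ∈T))))

interleave : ∀ {k} → Subset k → Subset k → Subset (double k)
interleave [] [] = []
interleave (x ∷ A) (y ∷ B) = x ∷ y ∷ interleave A B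

left∈interleave : ∀ {k} {A B : Subset k} {l} → l ∈ A → left l ∈ interleave A B
left∈interleave {B = _ ∷ _} here = here
left∈interleave {B = _ ∷ _} (there l∈A) = there (there (left∈interleave l∈A))

right∈interleave : ∀ {k} {A B : Subset k} {l} → l ∈ B → right l ∈ interleave A B
right∈interleave {A = _ ∷ _} here = there here
right∈interleave {A = _ ∷ _} (there l∈B) = there (there (right∈interleave l∈B))

interleave-partialTransversal : ∀ {k} {A B : Subset k} → (∀ {l} → l ∈ A → l ∉ B) →
                                IsPartialTransversal (interleave A B)
interleave-partialTransversal {A = []} {[]} _ ()
interleave-partialTransversal {A = x ∷ A} {y ∷ B} disjoint =
  partialTransversal-∷⁺ (λ { (refl , refl) → disjoint here here })
    (interleave-partialTransversal (λ l∈A l∈B → disjoint (there l∈A) (there l∈B)))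

∣interleave∣ : ∀ {k} (A B : Subset k) → ∣ interleave A B ∣ ≡ ∣ A ∣ ℕ.+ ∣ B ∣
∣interleave∣ [] [] = refl
∣interleave∣ (outside ∷ A) (outside ∷ B) = ∣interleave∣ A B
∣interleave∣ (outside ∷ A) (inside ∷ B) =
  trans (cong suc (∣interleave∣ A B)) (≡.sym (ℕₚ.+-suc ∣ A ∣ ∣ B ∣))
∣interleave∣ (inside ∷ A) (outside ∷ B) = cong suc (∣interleave∣ A B)
∣interleave∣ (inside ∷ A) (inside ∷ B) =
  cong suc (trans (cong suc (∣interleave∣ A B)) (≡.sym (ℕₚ.+-suc ∣ A ∣ ∣ B ∣)))

prependLefts : ∀ s {p} → Subset (double p) → Subset (double (s ℕ.+ p))
prependLefts zero K = K
prependLefts (suc s) K = inside ∷ outside ∷ prependLefts s K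

module _ {p : ℕ} where

  prependLefts-partialTransversal : ∀ s {K : Subset (double p)} → IsPartialTransversal K →
                                    IsPartialTransversal (prependLefts s K)
  prependLefts-partialTransversal zero pt = pt
  prependLefts-partialTransversal (suc s) pt =
    partialTransversal-∷⁺ (λ { (_ , ()) }) (prependLefts-partialTransversal s pt)

  ∣prependLefts∣ : ∀ s (K : Subset (double p)) → ∣ prependLefts s K ∣ ≡ s ℕ.+ ∣ K ∣
  ∣prependLefts∣ zero K = refl
  ∣prependLefts∣ (suc s) K = cong suc (∣prependLefts∣ s K)

  left∈prependLefts : ∀ s {K : Subset (double p)} {l} → left l ∈ K → left (s ↑ʳ l) ∈ prependLefts s K
  left∈prependLefts zero l∈K = l∈K
  left∈prependLefts (suc s) l∈K = there (there (left∈prependLefts s l∈K))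

  right∈prependLefts : ∀ s {K : Subset (double p)} {l} → right l ∈ K → right (s ↑ʳ l) ∈ prependLefts s K
  right∈prependLefts zero r∈K = r∈K
  right∈prependLefts (suc s) r∈K = there (there (right∈prependLefts s r∈K))

separatingClique : ∀ s {p} → Fin p → Fin p → Subset (double (s ℕ.+ p))
separatingClique s i j = prependLefts s (interleave ⁅ i ⁆ ⁅ j ⁆)

module _ (s : ℕ) {p : ℕ} {i j : Fin p} where

  left∈separatingClique : left (s ↑ʳ i) ∈ separatingClique s i j
  left∈separatingClique = left∈prependLefts s (left∈interleave (x∈⁅x⁆ i))

  right∈separatingClique : right (s ↑ʳ j) ∈ separatingClique s i j
  right∈separatingClique = right∈prependLefts s (right∈interleave (x∈⁅x⁆ j))

  separatingClique-isTClique : i ≢ j →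
                               IsTClique (cocktailParty (s ℕ.+ p)) (2 ℕ.+ s) (separatingClique s i j)
  separatingClique-isTClique i≢j =
    partialTransversal⇒clique (_ , left∈separatingClique)
      (prependLefts-partialTransversal s (interleave-partialTransversal disjoint)) ,
    size
    where
    disjoint : ∀ {l} → l ∈ ⁅ i ⁆ → l ∉ ⁅ j ⁆
    disjoint l∈i l∈j = i≢j (trans (≡.sym (x∈⁅y⁆⇒x≡y i l∈i)) (x∈⁅y⁆⇒x≡y j l∈j))
    size : ∣ separatingClique s i j ∣ ≡ 2 ℕ.+ s
    size = begin
      ∣ prependLefts s (interleave ⁅ i ⁆ ⁅ j ⁆) ∣ ≡⟨ ∣prependLefts∣ s _ ⟩
      s ℕ.+ ∣ interleave ⁅ i ⁆ ⁅ j ⁆ ∣           ≡⟨ cong (s ℕ.+_) (∣interleave∣ ⁅ i ⁆ ⁅ j ⁆) ⟩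
      s ℕ.+ (∣ ⁅ i ⁆ ∣ ℕ.+ ∣ ⁅ j ⁆ ∣)            ≡⟨ cong (s ℕ.+_) (cong₂ ℕ._+_ (∣⁅x⁆∣≡1 i) (∣⁅x⁆∣≡1 j)) ⟩
      s ℕ.+ 2                                    ≡⟨ ℕₚ.+-comm s 2 ⟩
      2 ℕ.+ s                                    ∎
      where open ≡-Reasoning

cocktailParty-coverSize : ∀ s p {g} → IsTCliqueCover (cocktailParty (s ℕ.+ p)) (2 ℕ.+ s) g →
                          p ℕ.≤ 2 ^ coverSize g
cocktailParty-coverSize s p cover = ≤2^coverSize (cocktailParty (s ℕ.+ p)) cover (λ i → left (s ↑ʳ i))
  λ {i} {j} i≢j →
    separatingClique s i j , separatingClique-isTClique s i≢j , left∈separatingClique s ,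
    λ K clique T⊆K → partialTransversal-omits (clique⇒partialTransversal clique) (T⊆K (right∈separatingClique s))

double≡2* : ∀ k → double k ≡ 2 * k
double≡2* zero = refl
double≡2* (suc k) = cong suc (trans (cong suc (double≡2* k)) (≡.sym (ℕₚ.+-suc k (k ℕ.+ 0))))

1+n≤2^n : ∀ n → suc n ℕ.≤ 2 ^ n
1+n≤2^n zero = s≤s z≤n
1+n≤2^n (suc n) =
  ℕₚ.+-mono-≤ (ℕₚ.m^n>0 2 n) (ℕₚ.≤-trans (1+n≤2^n n) (ℕₚ.m≤m+n (2 ^ n) 0))

m+n≤2^m*n : ∀ m n → 1 ℕ.≤ n → m ℕ.+ n ℕ.≤ 2 ^ m * n
m+n≤2^m*n m (suc n) _ = begin
  m ℕ.+ suc n            ≡⟨ ℕₚ.+-suc m n ⟩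
  suc m ℕ.+ n            ≤⟨ ℕₚ.+-mono-≤ (1+n≤2^n m) (ℕₚ.m≤n*m n (2 ^ m) {{ℕₚ.m^n≢0 2 m}}) ⟩
  2 ^ m ℕ.+ 2 ^ m * n    ≡⟨ ≡.sym (ℕₚ.*-suc (2 ^ m) n) ⟩
  2 ^ m * suc n          ∎
  where open ℕₚ.≤-Reasoning

⌊log₂double⌋≤ : ∀ s p m → 2 ℕ.≤ p → p ℕ.≤ 2 ^ m →
                ⌊log₂ double (s ℕ.+ p) ⌋ ℕ.≤ 2 ^ (2 ℕ.+ s) * m
⌊log₂double⌋≤ s p zero (s≤s (s≤s _)) (s≤s ())
⌊log₂double⌋≤ s p m@(suc _) 2≤p p≤2^m = begin
  ⌊log₂ double (s ℕ.+ p) ⌋       ≤⟨ ⌊log₂⌋-mono-≤ double≤ ⟩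
  ⌊log₂ 2 ^ (suc s ℕ.+ m) ⌋      ≡⟨ ⌊log₂[2^n]⌋≡n (suc s ℕ.+ m) ⟩
  suc s ℕ.+ m                    ≤⟨ ℕₚ.n≤1+n _ ⟩
  2 ℕ.+ s ℕ.+ m                  ≤⟨ m+n≤2^m*n (2 ℕ.+ s) m (s≤s z≤n) ⟩
  2 ^ (2 ℕ.+ s) * m              ∎
  where
  open ℕₚ.≤-Reasoning
  double≤ : double (s ℕ.+ p) ℕ.≤ 2 ^ (suc s ℕ.+ m)
  double≤ = begin
    double (s ℕ.+ p)     ≡⟨ double≡2* (s ℕ.+ p) ⟩
    2 * (s ℕ.+ p)        ≤⟨ ℕₚ.*-monoʳ-≤ 2 (m+n≤2^m*n s p (ℕₚ.≤-trans (s≤s z≤n) 2≤p)) ⟩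
    2 * (2 ^ s * p)      ≤⟨ ℕₚ.*-monoʳ-≤ 2 (ℕₚ.*-monoʳ-≤ (2 ^ s) p≤2^m) ⟩
    2 * (2 ^ s * 2 ^ m)  ≡⟨ cong (2 *_) (≡.sym (ℕₚ.^-distribˡ-+-* 2 s m)) ⟩
    2 ^ (suc s ℕ.+ m)    ∎

½^-cancel : ∀ t q → (toℚ (2 ^ t) ℚ.* ½^ t) ℚ.* q ≡ q
½^-cancel t q = trans (cong (ℚ._* q) (toℚ[2^e]*½^e≡1 t)) (ℚₚ.*-identityˡ q)

scaled-log-bound : ∀ t {L m w} → w ≡ toℚ (2 ^ t) → L ℕ.≤ 2 ^ t * m →
                   ((½^ t ℚ.* ½^ t) ℚ.* toℚ L) ℚ.* w ≤ toℚ m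
scaled-log-bound t {L} {m} refl L≤ = begin
  ((½^ t ℚ.* ½^ t) ℚ.* toℚ L) ℚ.* toℚ (2 ^ t)
    ≡⟨ solve 3 (λ h l w → ((h :* h) :* l) :* w := (w :* h) :* (h :* l)) refl (½^ t) (toℚ L) (toℚ (2 ^ t)) ⟩
  (toℚ (2 ^ t) ℚ.* ½^ t) ℚ.* (½^ t ℚ.* toℚ L)
    ≡⟨ ½^-cancel t _ ⟩
  ½^ t ℚ.* toℚ L
    ≤⟨ ℚₚ.*-monoˡ-≤-nonNeg (½^ t) {{ℚₚ.pos⇒nonNeg (½^ t) {{½^-pos t}}}} (toℚ-mono-≤ L≤) ⟩
  ½^ t ℚ.* toℚ (2 ^ t * m)
    ≡⟨ cong (½^ t ℚ.*_) (toℚ-* (2 ^ t) m) ⟩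
  ½^ t ℚ.* (toℚ (2 ^ t) ℚ.* toℚ m)
    ≡⟨ solve 3 (λ h w x → h :* (w :* x) := (w :* h) :* x) refl (½^ t) (toℚ (2 ^ t)) (toℚ m) ⟩
  (toℚ (2 ^ t) ℚ.* ½^ t) ℚ.* toℚ m
    ≡⟨ ½^-cancel t (toℚ m) ⟩
  toℚ m ∎
  where
  open ℚₚ.≤-Reasoning
  open +-*-Solver

HasLogGap : ℕ → ℚ → ℕ → Set
HasLogGap t C n =
  ∃[ G ] (∃[ T ] IsTClique {n} G t T) ×
    (∃[ f ] IsFracTCliqueCover G t f ×
      ((g : Subset n → Bool) → IsTCliqueCover G t g →
        (C ℚ.* toℚ ⌊log₂ n ⌋) ℚ.* fracWeight f ≤ toℚ (coverSize g)))

cocktailParty-hasLogGap : ∀ s d →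
  HasLogGap (2 ℕ.+ s) (½^ (2 ℕ.+ s) ℚ.* ½^ (2 ℕ.+ s)) (double (s ℕ.+ (2 ℕ.+ d)))
cocktailParty-hasLogGap s d =
  cocktailParty k ,
  (separatingClique s zero (suc zero) , separatingClique-isTClique s {i = zero} {j = suc zero} (λ ())) ,
  transversalCover t , transversalCover-isFracTCliqueCover t 0<k ,
  λ g cover → scaled-log-bound t (fracWeight-transversalCover t k)
    (⌊log₂double⌋≤ s p (coverSize g) (s≤s (s≤s z≤n)) (cocktailParty-coverSize s p cover))
  where
  t = 2 ℕ.+ s
  p = 2 ℕ.+ d
  k = s ℕ.+ p
  0<k : 0 ℕ.< k
  0<k = ℕₚ.≤-trans (s≤s z≤n) (ℕₚ.m≤n+m p s)

proposition5p3 : (t : ℕ) → 2 Data.Nat.≤ t →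
    ∃[ C ] (0ℚ < C ×
      ((k n : ℕ) → n ≡ 2 * k → 2 * t Data.Nat.≤ n →
        ∃[ G ] (∃[ T ] IsTClique {n} G t T) ×
          (∃[ f ] IsFracTCliqueCover G t f ×
            ((g : _) → IsTCliqueCover G t g →
              (C Data.Rational.* (+ ⌊log₂ n ⌋ / 1)) Data.Rational.* fracWeight f
                ≤ (+ coverSize g / 1)))))
proposition5p3 t@(suc (suc s)) (s≤s (s≤s z≤n)) =
  C , ℚₚ.positive⁻¹ C {{ℚₚ.pos*pos⇒pos (½^ t) {{½^-pos t}} (½^ t) {{½^-pos t}}}} ,
  λ k n n≡2k 2t≤n →
    subst (HasLogGap t C) (vertexCount k n n≡2k 2t≤n) (cocktailParty-hasLogGap s (k ℕ.∸ t))
  where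
  C = ½^ t ℚ.* ½^ t
  vertexCount : ∀ k n → n ≡ 2 * k → 2 * t ℕ.≤ n → double (s ℕ.+ (2 ℕ.+ (k ℕ.∸ t))) ≡ n
  vertexCount k n n≡2k 2t≤n = trans (cong double s+p≡k) (trans (double≡2* k) (≡.sym n≡2k))
    where
    t≤k : t ℕ.≤ k
    t≤k = ℕₚ.*-cancelˡ-≤ 2 (subst (2 * t ℕ.≤_) n≡2k 2t≤n)
    s+p≡k : s ℕ.+ (2 ℕ.+ (k ℕ.∸ t)) ≡ k
    s+p≡k = trans (ℕₚ.+-suc s _) (trans (cong suc (ℕₚ.+-suc s _)) (ℕₚ.m+[n∸m]≡n t≤k))
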